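{- Let $k\geq 2$ be an integer and let $G$ be a graph of order $n$ and size $m$ with minimum degree $\delta(G)\geq k$ and maximum degree $\Delta(G)$. Then \[ \gamma_{\times k,t}(G_I)\geq \max\{nk,\ \lceil 2km/\Delta(G)\rceil\}. \]
   Context: All graphs are finite, simple and undirected. For a graph $G$ without isolated vertices, the inflated graph $G_I$ is obtained as follows: each vertex $x_i$ of $G$ of degree $d(x_i)$ is replaced by a clique $X_i\cong K_{d(x_i)}$ whose vertices are labelled $x_ix_j$, one for each neighbour $x_j$ of $x_i$; and each edge $x_ix_j$ of $G$ is replaced by the edge joining $x_ix_j\in X_i$ to $x_jx_i\in X_j$. For an integer $k\geq1$, a set $S\subseteq V(H)$ is a $k$-tuple total dominating set of a graph $H$ if every vertex of $H$ has at least $k$ neighbours in $S$; $\gamma_{\times k,t}(H)$ denotes the minimum cardinality of such a set. -}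

module Defs where

open import Data.Nat using (ℕ; zero; suc; _+_; _*_; _⊔_; _<ᵇ_)
open import Data.Nat.DivMod using (_/_)
open import Data.Bool using (Bool; true; false; if_then_else_; _∧_; _∨_; not)
open import Data.Fin using (Fin; toℕ) renaming (zero to fzero; suc to fsuc)
import Data.Fin as F
open import Relation.Nullary.Decidable using (⌊_⌋)
open import Relation.Binary.PropositionalEquality using (_≡_)

record Graph (n : ℕ) : Set where
  field
    adj    : Fin n → Fin n → Bool
    sym    : ∀ i j → adj i j ≡ adj j i
    irrefl : ∀ i → adj i i ≡ false
open Graph public

sumF : {n : ℕ} → (Fin n → ℕ) → ℕ
sumF {zero}  f = 0
sumF {suc n} f = f fzero + sumF (λ i → f (fsuc i))

maxF : {n : ℕ} → (Fin n → ℕ) → ℕ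
maxF {zero}  f = 0
maxF {suc n} f = f fzero ⊔ maxF (λ i → f (fsuc i))

𝟙 : Bool → ℕ
𝟙 b = if b then 1 else 0

countF : {n : ℕ} → (Fin n → Bool) → ℕ
countF f = sumF (λ i → 𝟙 (f i))

countF² : {n : ℕ} → (Fin n → Fin n → Bool) → ℕ
countF² f = sumF (λ i → countF (f i))

_==_ : {n : ℕ} → Fin n → Fin n → Bool
i == j = ⌊ i F.≟ j ⌋

module _ {n : ℕ} (G : Graph n) where

  deg : Fin n → ℕ
  deg i = countF (adj G i)

  maxDeg : ℕ
  maxDeg = maxF deg

  -- size m = |E(G)| : unordered pairs {i , j} (counted with i < j) that are adjacent
  size : ℕ
  size = countF² (λ i j → (toℕ i <ᵇ toℕ j) ∧ adj G i j)

  MinDegAtLeast : ℕ → Set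
  MinDegAtLeast k = ∀ i → k Data.Nat.≤ deg i

  -- Inflated graph G_I.  Its vertices are the ordered pairs (i , j) with
  -- adj G i j ≡ true (vertex x_i x_j of the clique X_i).
  IVertex : Fin n → Fin n → Set
  IVertex i j = adj G i j ≡ true

  -- adjacency in G_I between x_i x_j and x_a x_b (both vertices of G_I):
  -- same clique X_i and distinct, or the edge x_i x_j -- x_j x_i.
  iadj : Fin n → Fin n → Fin n → Fin n → Bool
  iadj i j a b = adj G i j ∧ adj G a b ∧
                 (((i == a) ∧ not (j == b)) ∨ ((a == j) ∧ (b == i)))

  record ISubset : Set where
    field
      mem    : Fin n → Fin n → Bool
      mem⊆V  : ∀ i j → mem i j ≡ true → IVertex i j
  open ISubset public

  card : ISubset → ℕ
  card S = countF² (mem S)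

  nbrsIn : ISubset → Fin n → Fin n → ℕ
  nbrsIn S i j = countF² (λ a b → mem S a b ∧ iadj i j a b)

  IsKTupleTDS : ℕ → ISubset → Set
  IsKTupleTDS k S = ∀ i j → IVertex i j → k Data.Nat.≤ nbrsIn S i j

-- ceiling of a / b for b ≥ 1 (set to 0 when b = 0; never used then)
⌈_/_⌉ : ℕ → ℕ → ℕ
⌈ a / zero ⌉  = 0
⌈ a / suc b ⌉ = (a + b) / suc b

-- Let S be a k-tuple total dominating set of G_I.
--  * Clique bound.  A vertex x_i x_j has as neighbours the other vertices of
--    its clique X_i plus the single vertex x_j x_i, so it has at most
--    |S ∩ X_i| - [x_i x_j ∈ S] + 1 neighbours in S.  Since X_i is nonempty
--    and k ≥ 2, this first forces S ∩ X_i ≠ ∅, and then, applied to a vertex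
--    x_i x_j ∈ S, gives |S ∩ X_i| ≥ k.  Summing over the n cliques: |S| ≥ n k.
--  * Handshake bound.  2 m ≤ Σ_i d(x_i) ≤ n Δ, hence 2 k m ≤ n k Δ, and so
--    ⌈2 k m / Δ⌉ ≤ n k ≤ |S|.
module Submission where

open import Defs
open import Data.Nat using (ℕ; _≤_; _*_; _⊔_)
open import Data.Nat.Base using (zero; suc; _+_; _<ᵇ_; z≤n; s≤s)
open import Data.Nat.Properties
open import Data.Nat.DivMod using (_/_; m<n*o⇒m/o<n)
open import Data.Bool using (Bool; true; false; _∧_; _∨_; not)
open import Data.Fin using (Fin; toℕ) renaming (zero to fzero; suc to fsuc)
import Data.Fin as F
open import Data.Fin.Properties using () renaming (suc-injective to fsuc-injective)
open import Data.Product using (∃; _,_)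
open import Data.Empty using (⊥; ⊥-elim)
open import Function using (_∘_)
open import Relation.Nullary.Decidable using (dec-true; dec-false; isYes≗does)
open import Relation.Binary.PropositionalEquality as ≡
  using (_≡_; _≢_; refl; cong; cong₂; trans; subst)
import Algebra.Properties.CommutativeMonoid.Sum as CMSum

-- sumF agrees with the library's finite sum over the monoid (ℕ, +, 0), whose
-- algebraic laws we reuse instead of re-deriving them.
module ∑ = CMSum +-0-commutativeMonoid

sumF≡∑ : ∀ {n} (f : Fin n → ℕ) → sumF f ≡ ∑.sum f
sumF≡∑ {zero}  f = refl
sumF≡∑ {suc n} f = cong (f fzero +_) (sumF≡∑ (f ∘ fsuc))

sumF-cong : ∀ {n} {f g : Fin n → ℕ} → (∀ i → f i ≡ g i) → sumF f ≡ sumF g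
sumF-cong {zero}  e = refl
sumF-cong {suc n} e = cong₂ _+_ (e fzero) (sumF-cong (e ∘ fsuc))

sumF-mono : ∀ {n} {f g : Fin n → ℕ} → (∀ i → f i ≤ g i) → sumF f ≤ sumF g
sumF-mono {zero}  e = z≤n
sumF-mono {suc n} e = +-mono-≤ (e fzero) (sumF-mono (e ∘ fsuc))

sumF-const : ∀ {n} c → sumF {n} (λ _ → c) ≡ n * c
sumF-const {zero}  c = refl
sumF-const {suc n} c = cong (c +_) (sumF-const {n} c)

sumF-zero : ∀ {n} {f : Fin n → ℕ} → (∀ i → f i ≡ 0) → sumF f ≡ 0
sumF-zero {n} e = trans (sumF-cong {g = λ _ → 0} e) (trans (sumF-const {n} 0) (*-zeroʳ n))

sumF-+ : ∀ {n} (f g : Fin n → ℕ) → sumF (λ i → f i + g i) ≡ sumF f + sumF g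
sumF-+ f g = trans (sumF≡∑ (λ i → f i + g i))
  (trans (∑.∑-distrib-+ f g) (≡.sym (cong₂ _+_ (sumF≡∑ f) (sumF≡∑ g))))

sumF-swap : ∀ {n m} (f : Fin n → Fin m → ℕ) →
  sumF (λ i → sumF (f i)) ≡ sumF (λ j → sumF (λ i → f i j))
sumF-swap f = begin
    sumF (λ i → sumF (f i))                  ≡⟨ sumF-cong (λ i → sumF≡∑ (f i)) ⟩
    sumF (λ i → ∑.sum (f i))                 ≡⟨ sumF≡∑ (λ i → ∑.sum (f i)) ⟩
    ∑.sum (λ i → ∑.sum (f i))                ≡⟨ ∑.∑-comm f ⟩
    ∑.sum (λ j → ∑.sum (λ i → f i j))        ≡⟨ ≡.sym (sumF≡∑ (λ j → ∑.sum (λ i → f i j))) ⟩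
    sumF (λ j → ∑.sum (λ i → f i j))         ≡⟨ ≡.sym (sumF-cong (λ j → sumF≡∑ (λ i → f i j))) ⟩
    sumF (λ j → sumF (λ i → f i j))          ∎
  where open ≡.≡-Reasoning

sumF-single : ∀ {n} {f : Fin n → ℕ} (i : Fin n) →
  (∀ a → a ≢ i → f a ≡ 0) → sumF f ≡ f i
sumF-single {suc n} {f} fzero     off =
  trans (cong (f fzero +_) (sumF-zero (λ a → off (fsuc a) λ ())))
        (+-identityʳ (f fzero))
sumF-single {suc n} {f} (fsuc i) off = cong₂ _+_
  (off fzero λ ())
  (sumF-single i (λ a a≢i → off (fsuc a) (a≢i ∘ fsuc-injective)))

sumF≤n*maxF : ∀ {n} (f : Fin n → ℕ) → sumF f ≤ n * maxF f
sumF≤n*maxF {zero}  f = z≤n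
sumF≤n*maxF {suc n} f = +-mono-≤ (m≤m⊔n _ _)
  (≤-trans (sumF≤n*maxF (f ∘ fsuc)) (*-monoʳ-≤ n (m≤n⊔m (f fzero) _)))

countF²-≤-+ : ∀ {n} (f g h : Fin n → Fin n → Bool) →
  (∀ a b → 𝟙 (f a b) ≤ 𝟙 (g a b) + 𝟙 (h a b)) →
  countF² f ≤ countF² g + countF² h
countF²-≤-+ f g h le = begin
    countF² f                                   ≤⟨ sumF-mono (λ a → sumF-mono (le a)) ⟩
    sumF (λ a → sumF (λ b → 𝟙 (g a b) + 𝟙 (h a b)))
      ≡⟨ sumF-cong (λ a → sumF-+ (λ b → 𝟙 (g a b)) (λ b → 𝟙 (h a b))) ⟩
    sumF (λ a → countF (g a) + countF (h a))    ≡⟨ sumF-+ (countF ∘ g) (countF ∘ h) ⟩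
    countF² g + countF² h                       ∎
  where open ≤-Reasoning

countF-witness : ∀ {n} (f : Fin n → Bool) → 1 ≤ countF f → ∃ λ j → f j ≡ true
countF-witness {suc n} f h with f fzero in e
... | true  = fzero , e
... | false = let (j , p) = countF-witness (f ∘ fsuc) h in fsuc j , p

==-self : ∀ {n} (i : Fin n) → (i == i) ≡ true
==-self i = trans (isYes≗does (i F.≟ i)) (dec-true (i F.≟ i) refl)

==-distinct : ∀ {n} {a i : Fin n} → a ≢ i → (a == i) ≡ false
==-distinct {a = a} {i} a≢i = trans (isYes≗does (a F.≟ i)) (dec-false (a F.≟ i) a≢i)

count-== : ∀ {n} (i : Fin n) → countF (λ b → b == i) ≡ 1
count-== i = trans (sumF-single i (λ a a≢i → cong 𝟙 (==-distinct a≢i)))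
                   (cong 𝟙 (==-self i))

count-guarded : ∀ {n} (g : Fin n → Bool) (P : Fin n → Fin n → Bool) (i : Fin n) →
  g i ≡ true → (∀ a → a ≢ i → g a ≡ false) →
  countF² (λ a b → g a ∧ P a b) ≡ countF (P i)
count-guarded {n} g P i gi off = trans (sumF-single i vanish) at-i
  where
  vanish : ∀ a → a ≢ i → countF (λ b → g a ∧ P a b) ≡ 0
  vanish a a≢i rewrite off a a≢i = sumF-zero {n} {f = λ _ → 0} (λ _ → refl)
  at-i : countF (λ b → g i ∧ P i b) ≡ countF (P i)
  at-i rewrite gi = refl

split𝟙 : ∀ x q → 𝟙 x ≡ 𝟙 (x ∧ not q) + 𝟙 (q ∧ x)
split𝟙 false false = refl
split𝟙 false true  = refl
split𝟙 true  false = refl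
split𝟙 true  true  = refl

count-remove : ∀ {n} (f : Fin n → Bool) (j : Fin n) →
  countF f ≡ countF (λ b → f b ∧ not (j == b)) + 𝟙 (f j)
count-remove f j = begin
    countF f                                                   ≡⟨ sumF-cong (λ b → split𝟙 (f b) (j == b)) ⟩
    sumF (λ b → 𝟙 (f b ∧ not (j == b)) + 𝟙 ((j == b) ∧ f b))   ≡⟨ sumF-+ (λ b → 𝟙 (f b ∧ not (j == b))) (λ b → 𝟙 ((j == b) ∧ f b)) ⟩
    countF (λ b → f b ∧ not (j == b)) + countF (λ b → (j == b) ∧ f b)
      ≡⟨ cong (countF (λ b → f b ∧ not (j == b)) +_) (sumF-single j vanish) ⟩
    countF (λ b → f b ∧ not (j == b)) + 𝟙 ((j == j) ∧ f j)
      ≡⟨ cong (λ t → countF (λ b → f b ∧ not (j == b)) + 𝟙 (t ∧ f j)) (==-self j) ⟩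
    countF (λ b → f b ∧ not (j == b)) + 𝟙 (f j)               ∎
  where
  open ≡.≡-Reasoning
  vanish : ∀ b → b ≢ j → 𝟙 ((j == b) ∧ f b) ≡ 0
  vanish b b≢j rewrite ==-distinct (b≢j ∘ ≡.sym) = refl

<ᵇ-asym : ∀ x y → (x <ᵇ y) ≡ true → (y <ᵇ x) ≡ true → ⊥
<ᵇ-asym (suc x) (suc y) p q = <ᵇ-asym x y p q

module _ {n : ℕ} (G : Graph n) where

  private
    lowerEdge : Fin n → Fin n → ℕ
    lowerEdge i j = 𝟙 ((toℕ i <ᵇ toℕ j) ∧ adj G i j)

  lowerEdge-pair : ∀ i j → lowerEdge i j + lowerEdge j i ≤ 𝟙 (adj G i j)
  lowerEdge-pair i j rewrite Graph.sym G j i =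
    atMostOne (toℕ i <ᵇ toℕ j) (toℕ j <ᵇ toℕ i) (adj G i j) (<ᵇ-asym (toℕ i) (toℕ j))
    where
    atMostOne : ∀ x y e → (x ≡ true → y ≡ true → ⊥) → 𝟙 (x ∧ e) + 𝟙 (y ∧ e) ≤ 𝟙 e
    atMostOne false false e _ = z≤n
    atMostOne false true  e _ = ≤-refl
    atMostOne true  false e _ = ≤-reflexive (+-identityʳ _)
    atMostOne true  true  e h = ⊥-elim (h refl refl)

  twice-size≤degree-sum : 2 * size G ≤ sumF (deg G)
  twice-size≤degree-sum = begin
      2 * size G                                     ≡⟨ cong (size G +_) (+-identityʳ _) ⟩
      size G + size G                                ≡⟨ cong (size G +_) (sumF-swap lowerEdge) ⟩
      size G + sumF (λ i → sumF (λ j → lowerEdge j i))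
        ≡⟨ ≡.sym (sumF-+ (λ i → sumF (lowerEdge i)) (λ i → sumF (λ j → lowerEdge j i))) ⟩
      sumF (λ i → sumF (lowerEdge i) + sumF (λ j → lowerEdge j i))
        ≡⟨ sumF-cong (λ i → ≡.sym (sumF-+ (lowerEdge i) (λ j → lowerEdge j i))) ⟩
      sumF (λ i → sumF (λ j → lowerEdge i j + lowerEdge j i))
        ≤⟨ sumF-mono (λ i → sumF-mono (lowerEdge-pair i)) ⟩
      sumF (deg G)                                   ∎
    where open ≤-Reasoning

  twice-size≤n*maxDeg : 2 * size G ≤ n * maxDeg G
  twice-size≤n*maxDeg = ≤-trans twice-size≤degree-sum (sumF≤n*maxF (deg G))

module _ {n : ℕ} (G : Graph n) (S : ISubset G) where

  cliqueCount : Fin n → ℕ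
  cliqueCount i = countF (mem S i)

  -- Pointwise: a member ab of S adjacent to x_i x_j is either in X_i and
  -- different from x_i x_j, or it is the vertex x_j x_i.
  private
    neighbour-cases : ∀ s e e′ p q r t →
      𝟙 (s ∧ (e ∧ e′ ∧ ((p ∧ not q) ∨ (r ∧ t)))) ≤ 𝟙 (p ∧ (s ∧ not q)) + 𝟙 (r ∧ t)
    neighbour-cases false e     e′    p     q     r t = z≤n
    neighbour-cases true  false e′    p     q     r t = z≤n
    neighbour-cases true  true  false p     q     r t = z≤n
    neighbour-cases true  true  true  false q     r t = ≤-refl
    neighbour-cases true  true  true  true  false r t = s≤s z≤n
    neighbour-cases true  true  true  true  true  r t = ≤-refl

  neighbours-bound : ∀ i j →
    𝟙 (mem S i j) + nbrsIn G S i j ≤ suc (cliqueCount i)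
  neighbours-bound i j = begin
      𝟙 (mem S i j) + nbrsIn G S i j
        ≤⟨ +-monoʳ-≤ (𝟙 (mem S i j)) (countF²-≤-+ _ insideX_i edgeTo-x_jx_i
             (λ a b → neighbour-cases (mem S a b) (adj G i j) (adj G a b)
                        (i == a) (j == b) (a == j) (b == i))) ⟩
      𝟙 (mem S i j) + (countF² insideX_i + countF² edgeTo-x_jx_i)
        ≡⟨ cong (λ t → 𝟙 (mem S i j) + t) (cong₂ _+_
             (count-guarded (i ==_) _ i (==-self i)
                (λ a a≢i → ==-distinct (a≢i ∘ ≡.sym)))
             (trans (count-guarded (_== j) _ j (==-self j) (λ _ → ==-distinct))
                    (count-== i))) ⟩
      𝟙 (mem S i j) + (others + 1)
        ≡⟨ trans (cong (𝟙 (mem S i j) +_) (+-comm others 1)) (+-suc (𝟙 (mem S i j)) others) ⟩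
      suc (𝟙 (mem S i j) + others)
        ≡⟨ cong suc (trans (+-comm (𝟙 (mem S i j)) others)
                           (≡.sym (count-remove (mem S i) j))) ⟩
      suc (cliqueCount i)                             ∎
    where
    open ≤-Reasoning
    insideX_i edgeTo-x_jx_i : Fin n → Fin n → Bool
    insideX_i a b = (i == a) ∧ (mem S a b ∧ not (j == b))
    edgeTo-x_jx_i a b = (a == j) ∧ (b == i)
    others : ℕ
    others = countF (λ b → mem S i b ∧ not (j == b))

  clique-bound : ∀ k → 2 ≤ k → IsKTupleTDS G k S →
    ∀ i → 1 ≤ deg G i → k ≤ cliqueCount i
  clique-bound k 2≤k tds i 1≤deg = +-cancelˡ-≤ 1 k (cliqueCount i) k+1≤
    where
    -- any vertex x_i x_j of X_i is k-dominated, so |S ∩ X_i| ≥ k - 1 ≥ 1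
    someVertex : ∃ λ j → adj G i j ≡ true
    someVertex = countF-witness (adj G i) 1≤deg
    nonempty : 1 ≤ cliqueCount i
    nonempty with (j , ij) ← someVertex = ≤-pred (≤-trans 2≤k (≤-trans (tds i j ij)
      (≤-trans (m≤n+m _ (𝟙 (mem S i j))) (neighbours-bound i j))))
    -- a vertex x_i x_j ∈ S is k-dominated, and is not its own neighbour
    k+1≤ : 1 + k ≤ 1 + cliqueCount i
    k+1≤ with (j , sij) ← countF-witness (mem S i) nonempty =
      ≤-trans (s≤s (tds i j (mem⊆V S i j sij)))
        (subst (λ t → 𝟙 t + nbrsIn G S i j ≤ suc (cliqueCount i)) sij (neighbours-bound i j))

⌈/⌉≤ : ∀ a d c → a ≤ c * d → ⌈ a / d ⌉ ≤ c
⌈/⌉≤ a zero    c _ = z≤n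
⌈/⌉≤ a (suc b) c a≤cd = ≤-pred (m<n*o⇒m/o<n {a + b} {suc c} {suc b}
  (≤-trans (+-mono-≤-< a≤cd (n<1+n b)) (≤-reflexive (+-comm (c * suc b) (suc b)))))

corollary2p2 : (k : ℕ) → 2 ≤ k → (n : ℕ) → (G : Graph n) →
                 MinDegAtLeast G k →
                 (S : ISubset G) → IsKTupleTDS G k S →
                 (n * k) ⊔ ⌈ 2 * k * size G / maxDeg G ⌉ ≤ card G S
corollary2p2 k 2≤k n G δ≥k S tds = ⊔-lub nk≤|S| (≤-trans ceil≤nk nk≤|S|)
  where
  open ≤-Reasoning
  nk≤|S| : n * k ≤ card G S
  nk≤|S| = begin
    n * k                   ≡⟨ ≡.sym (sumF-const {n} k) ⟩
    sumF {n} (λ _ → k)      ≤⟨ sumF-mono (λ i → clique-bound G S k 2≤k tds i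
                                  (≤-trans (≤-trans (s≤s z≤n) 2≤k) (δ≥k i))) ⟩
    card G S                ∎
  2km≤nkΔ : 2 * k * size G ≤ n * k * maxDeg G
  2km≤nkΔ = begin
    2 * k * size G          ≡⟨ cong (_* size G) (*-comm 2 k) ⟩
    k * 2 * size G          ≡⟨ *-assoc k 2 (size G) ⟩
    k * (2 * size G)        ≤⟨ *-monoʳ-≤ k (twice-size≤n*maxDeg G) ⟩
    k * (n * maxDeg G)      ≡⟨ ≡.sym (*-assoc k n (maxDeg G)) ⟩
    k * n * maxDeg G        ≡⟨ cong (_* maxDeg G) (*-comm k n) ⟩
    n * k * maxDeg G        ∎
  ceil≤nk : ⌈ 2 * k * size G / maxDeg G ⌉ ≤ n * k
  ceil≤nk = ⌈/⌉≤ _ (maxDeg G) (n * k) 2km≤nkΔ
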